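{- Let $t\ge 3$ and $1\le s\le t$ be integers and let $H$ be a connected non-bipartite graph. Then for every $n$ and every coloring of the edges of $K_n$ with $t$ colors, there is a family of pairwise vertex-disjoint monochromatic copies of $H$, whose colors together comprise at most $s$ distinct colors, covering at least $\frac{s(n-R_t(H))}{t}$ vertices. On the other hand, for every $n$ divisible by $t$, the edges of $K_n$ can be colored with $t$ colors so that every family of pairwise vertex-disjoint monochromatic copies of $H$ using at most $s$ colors in total covers at most $\frac{sn}{t}$ vertices.
   Context: $R_t(H)$ denotes the smallest integer $m$ such that in every coloring of the edges of $K_m$ with $t$ colors there is a monochromatic copy of $H$. A copy of $H$ is monochromatic if all of its edges receive the same color. -}

module Defs where

open import Level using (0ℓ)
open import Data.Nat using (ℕ; _≤_; _<_; _*_)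
open import Data.Fin using (Fin)
open import Data.Bool using (Bool)
open import Data.Product using (Σ; ∃; _×_; _,_)
open import Data.List using (List; length)
open import Data.List.Relation.Unary.All using (All)
open import Data.List.Relation.Unary.AllPairs using (AllPairs)
open import Data.List.Membership.Propositional using (_∈_)
open import Relation.Nullary using (¬_)
open import Relation.Binary.PropositionalEquality using (_≡_; _≢_)

record Graph : Set₁ where
  field
    k     : ℕ
    Adj   : Fin k → Fin k → Set
    sym   : ∀ {u v} → Adj u v → Adj v u
    irrefl : ∀ {u} → ¬ Adj u u
open Graph public

data Reach (H : Graph) : Fin (k H) → Fin (k H) → Set where
  here : ∀ {u} → Reach H u u
  step : ∀ {u v w} → Adj H u v → Reach H v w → Reach H u w

Connected : Graph → Set
Connected H = ∀ u v → Reach H u v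

Bipartite : Graph → Set
Bipartite H = Σ (Fin (k H) → Bool) λ f → ∀ u v → Adj H u v → f u ≢ f v

-- A t-colouring of the edges of K_n (value on the diagonal is irrelevant).
record Colouring (t n : ℕ) : Set where
  field
    col  : Fin n → Fin n → Fin t
    symm : ∀ i j → col i j ≡ col j i
open Colouring public

record MonoCopy (H : Graph) {t n : ℕ} (c : Colouring t n) : Set where
  field
    colour : Fin t
    emb    : Fin (k H) → Fin n
    inj    : ∀ u v → emb u ≡ emb v → u ≡ v
    mono   : ∀ u v → Adj H u v → col c (emb u) (emb v) ≡ colour
open MonoCopy public

HasMonoCopy : (t : ℕ) → Graph → ℕ → Set
HasMonoCopy t H m = (c : Colouring t m) → MonoCopy H c

IsRamseyNumber : (t : ℕ) → Graph → ℕ → Set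
IsRamseyNumber t H m = HasMonoCopy t H m × (∀ m' → m' < m → ¬ HasMonoCopy t H m')

Disjoint : {H : Graph} {t n : ℕ} {c : Colouring t n} → MonoCopy H c → MonoCopy H c → Set
Disjoint a b = ∀ u v → emb a u ≢ emb b v

GoodFamily : (H : Graph) {t n : ℕ} (c : Colouring t n) (s : ℕ) → List (MonoCopy H c) → Set
GoodFamily H c s F =
  AllPairs Disjoint F ×
  ∃ λ (S : List (Fin _)) → length S ≤ s × All (λ a → colour a ∈ S) F

-- Number of vertices covered by a family of pairwise disjoint copies of H
-- (each copy is injective, copies are disjoint, so this is |V(H)| * #copies).
covered : {H : Graph} {t n : ℕ} {c : Colouring t n} → List (MonoCopy H c) → ℕ
covered {H} F = k H * length F

module Submission where

-- Greedily remove monochromatic copies of H from K_n: while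
-- at least R vertices remain, the remaining complete graph contains one,
-- so the copies found cover all but fewer than R vertices
-- (`GreedyPacking`). Then keep the s colours that are most popular among
-- these copies; they carry at least an s/t fraction of them
-- (`ColourSelection`).
--
-- For n = q t split K_n into t parts of size q; colour the
-- edges inside part a with a, and an edge between parts a ≠ b with a colour
-- `partColour a b` different from a and b, chosen so that for each colour i
-- the i-coloured edges between parts form a bipartite graph. A monochromatic
-- copy of a connected non-bipartite H then lies in the part of its colour
-- (`PartColouring.inOwnPart`), so copies using s colours cover at most
-- s q = s n / t vertices (`Parts.inParts-bound`).

open import Defs hiding (sym)
open import Function using (_∘_; id)
open import Function.Definitions using (Injective)
open import Data.Empty using (⊥-elim)
open import Data.Nat using (ℕ; zero; suc; _+_; _*_; _∸_; _≤_; _<_; _>_; _≡ᵇ_; z≤n; s≤s)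
import Data.Nat as ℕ
open import Data.Nat.Properties
open import Data.Nat.Divisibility using (_∣_; divides)
open import Algebra.Properties.CommutativeSemigroup *-commutativeSemigroup
  using () renaming (x∙yz≈y∙xz to *-left-comm)
open import Data.Bool using (Bool; true; false; _∨_; _∧_)
open import Data.Bool.Properties using (∧-zeroʳ)
open import Data.Fin as Fin using (Fin; toℕ; fromℕ<; inject≤; punchIn; remQuot; combine)
import Data.Fin.Properties as FinP
open import Data.Product using (Σ; ∃; _×_; _,_; proj₁; proj₂; uncurry)
open import Data.List using (List; []; _∷_; length; filter; lookup; allFin)
open import Data.List.Properties using (filter-all; length-filter; length-removeAt′; length-tabulate)
open import Data.List.Relation.Unary.All as All using (All; []; _∷_)
open import Data.List.Relation.Unary.All.Properties using (all-filter)
open import Data.List.Relation.Unary.AllPairs using (AllPairs; []; _∷_)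
import Data.List.Relation.Unary.AllPairs.Properties as AllPairs
open import Data.List.Relation.Unary.Any as Any using (here; there)
open import Data.List.Relation.Unary.Any.Properties using (lookup-index)
open import Data.List.Membership.Propositional using (_∈_; _─_)
open import Data.List.Membership.Propositional.Properties using (∈-lookup; ∈-allFin)
open import Data.List.Relation.Binary.Sublist.Propositional.Properties
  using (filter⁺; filter-⊆; length-mono-≤)
open import Relation.Nullary using (¬_; yes; no; ¬?; contradiction)
open import Relation.Unary using (Decidable)
open import Relation.Binary.Definitions using (DecidableEquality; tri<; tri≈; tri>)
open import Relation.Binary.PropositionalEquality

length-filter-split : ∀ {A : Set} {P : A → Set} (P? : Decidable P) xs →
  length (filter P? xs) + length (filter (¬? ∘ P?) xs) ≡ length xs
length-filter-split P? [] = refl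
length-filter-split P? (x ∷ xs) with P? x
... | yes _ = cong suc (length-filter-split P? xs)
... | no _ = trans (+-suc _ _) (cong suc (length-filter-split P? xs))

-- If a colour holding a of a + b items has less than a (1 + m)-th of them,
-- while b ≤ m c, then a + b ≤ (1 + m) c: a colour holding c items has at
-- least a (1 + m)-th of them.
above-share : ∀ m a b c → a + b > suc m * a → b ≤ m * c → a + b ≤ suc m * c
above-share m a b c share b≤mc = +-mono-≤ (<⇒≤ a<c) b≤mc
  where
  a<c : a < c
  a<c = *-cancelˡ-< m a c (<-≤-trans (+-cancelˡ-< a (m * a) b share) b≤mc)

-- One round of colour selection: the chosen colour holds n of the n + l
-- items, at least a (1 + m)-th of them; the colours chosen afterwards leave
-- x of the other l items uncovered, with m x ≤ d l.
selection-step : ∀ m d n l x → n + l ≤ suc m * n → m * x ≤ d * l → x ≤ l →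
  suc m * x ≤ d * (n + l)
selection-step m d n l x popular bound x≤l = begin
  x + m * x ≤⟨ +-mono-≤ (x≤dn m (+-cancelˡ-≤ n l (m * n) popular) bound) bound ⟩
  d * n + d * l ≡⟨ *-distribˡ-+ d n l ⟨
  d * (n + l) ∎
  where
  open ≤-Reasoning
  x≤dn : ∀ m → l ≤ m * n → m * x ≤ d * l → x ≤ d * n
  x≤dn zero l≤0 _ = ≤-trans x≤l (≤-trans l≤0 z≤n)
  x≤dn m@(suc _) l≤mn mx≤dl = *-cancelˡ-≤ m (begin
    m * x ≤⟨ mx≤dl ⟩
    d * l ≤⟨ *-monoʳ-≤ d l≤mn ⟩
    d * (m * n) ≡⟨ *-left-comm d m n ⟩
    m * (d * n) ∎)

-- If at most a d/(s + d) fraction of c + x items is uncovered (x of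
-- them), the covered c items form at least an s/(s + d) fraction.
uncovered⇒covered : ∀ s d c x → (s + d) * x ≤ d * (c + x) → s * (c + x) ≤ (s + d) * c
uncovered⇒covered s d c x few = +-cancelʳ-≤ (d * (c + x)) (s * (c + x)) ((s + d) * c) (begin
  s * (c + x) + d * (c + x) ≡⟨ *-distribʳ-+ (c + x) s d ⟨
  (s + d) * (c + x) ≡⟨ *-distribˡ-+ (s + d) c x ⟩
  (s + d) * c + (s + d) * x ≤⟨ +-monoʳ-≤ ((s + d) * c) few ⟩
  (s + d) * c + d * (c + x) ∎)
  where open ≤-Reasoning

module ColourSelection {A C : Set} (_≟_ : DecidableEquality C) (colourOf : A → C) where
  open import Data.List.Membership.DecPropositional _≟_ using (_∈?_)

  ofColour otherColours : C → List A → List A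
  ofColour v = filter (λ x → colourOf x ≟ v)
  otherColours v = filter (λ x → ¬? (colourOf x ≟ v))

  inColours outsideColours : List C → List A → List A
  inColours S = filter (λ x → colourOf x ∈? S)
  outsideColours S = filter (λ x → ¬? (colourOf x ∈? S))

  ColouredBy : List C → List A → Set
  ColouredBy U L = All (λ x → colourOf x ∈ U) L

  otherColours-palette : ∀ {v U} (v∈U : v ∈ U) L → ColouredBy U L →
    ColouredBy (U ─ v∈U) (otherColours v L)
  otherColours-palette v∈U [] [] = []
  otherColours-palette {v} v∈U (x ∷ L) (x∈U ∷ col) with colourOf x ≟ v
  ... | yes _ = otherColours-palette v∈U L col
  ... | no x≢v = ∈-─ v∈U x∈U x≢v ∷ otherColours-palette v∈U L col
    where
    ∈-─ : ∀ {v w U} (v∈U : v ∈ U) → w ∈ U → w ≢ v → w ∈ U ─ v∈U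
    ∈-─ (here refl) (here refl) w≢v = contradiction refl w≢v
    ∈-─ (here refl) (there w∈U) _ = w∈U
    ∈-─ (there _) (here w≡u) _ = here w≡u
    ∈-─ (there v∈U) (there w∈U) w≢v = there (∈-─ v∈U w∈U w≢v)

  length-─ : ∀ {v : C} {U : List C} (v∈U : v ∈ U) → length U ≡ suc (length (U ─ v∈U))
  length-─ {U = U} v∈U = length-removeAt′ U (Any.index v∈U)

  outsideColours-∷ : ∀ v S L → outsideColours (v ∷ S) L ≡ outsideColours S (otherColours v L)
  outsideColours-∷ v S [] = refl
  outsideColours-∷ v S (x ∷ L) with colourOf x ≟ v
  ... | yes _ = outsideColours-∷ v S L
  ... | no _ with colourOf x ∈? S
  ...   | yes _ = outsideColours-∷ v S L
  ...   | no _ = cong (x ∷_) (outsideColours-∷ v S L)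

  mostPopular : ∀ u U L → ColouredBy (u ∷ U) L →
    ∃ λ v → v ∈ u ∷ U × length L ≤ length (u ∷ U) * length (ofColour v L)
  mostPopular u [] L col = u , here refl , ≤-reflexive (begin
    length L ≡⟨ cong length (filter-all (λ x → colourOf x ≟ u) (All.map single col)) ⟨
    length (ofColour u L) ≡⟨ *-identityˡ _ ⟨
    1 * length (ofColour u L) ∎)
    where
    open ≡-Reasoning
    single : ∀ {c} → c ∈ u ∷ [] → c ≡ u
    single (here c≡u) = c≡u
  mostPopular u U@(_ ∷ _) L col with length L ≤? length (u ∷ U) * length (ofColour u L)
  ... | yes popular = u , here refl , popular
  ... | no unpopular with mostPopular _ _ (otherColours u L) (otherColours-palette (here refl) L col)
  ...   | v , v∈U , popular′ = v , there v∈U , (begin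
    length L ≡⟨ split ⟨
    length (ofColour u L) + length (otherColours u L)
      ≤⟨ above-share (length U) _ _ _ share popular′ ⟩
    length (u ∷ U) * length (ofColour v (otherColours u L))
      ≤⟨ *-monoʳ-≤ (length (u ∷ U)) (length-mono-≤ (filter⁺ _ _ (λ { refl p → p }) (filter-⊆ _ L))) ⟩
    length (u ∷ U) * length (ofColour v L) ∎)
    where
    open ≤-Reasoning
    split : length (ofColour u L) + length (otherColours u L) ≡ length L
    split = length-filter-split (λ x → colourOf x ≟ u) L
    share : length (ofColour u L) + length (otherColours u L) > length (u ∷ U) * length (ofColour u L)
    share = subst (_> length (u ∷ U) * length (ofColour u L)) (sym split) (≰⇒> unpopular)

  selectUncovered : ∀ s d U L → ColouredBy U L → length U ≡ s + d →
    ∃ λ S → length S ≤ s × length U * length (outsideColours S L) ≤ d * length L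
  selectUncovered zero d U L _ |U| = [] , z≤n , ≤-reflexive (cong₂ _*_ |U| (cong length nothing-covered))
    where
    nothing-covered : outsideColours [] L ≡ L
    nothing-covered = filter-all _ (All.universal (λ _ ()) L)
  selectUncovered (suc s) d [] L _ ()
  selectUncovered (suc s) d U@(u ∷ _) L col |U|
    with mostPopular u _ L col
  ... | v , v∈U , popular
    with selectUncovered s d (U ─ v∈U) (otherColours v L) (otherColours-palette v∈U L col)
           (suc-injective (trans (sym (length-─ v∈U)) |U|))
  ... | S , |S|≤s , bound = v ∷ S , s≤s |S|≤s , (begin
    length U * length (outsideColours (v ∷ S) L)
      ≡⟨ cong₂ _*_ (length-─ v∈U) (cong length (outsideColours-∷ v S L)) ⟩
    suc m * length (outsideColours S (otherColours v L))
      ≤⟨ selection-step m d _ _ _ popular′ bound (length-filter _ (otherColours v L)) ⟩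
    d * (length (ofColour v L) + length (otherColours v L)) ≡⟨ cong (d *_) split ⟩
    d * length L ∎)
    where
    open ≤-Reasoning
    m = length (U ─ v∈U)
    split : length (ofColour v L) + length (otherColours v L) ≡ length L
    split = length-filter-split (λ x → colourOf x ≟ v) L
    popular′ : length (ofColour v L) + length (otherColours v L) ≤ suc m * length (ofColour v L)
    popular′ = subst₂ (λ a b → a ≤ b * length (ofColour v L)) (sym split) (length-─ v∈U) popular

  selectColours : ∀ s U L → ColouredBy U L → s ≤ length U →
    ∃ λ S → length S ≤ s × s * length L ≤ length U * length (inColours S L)
  selectColours s U L col s≤|U| with selectUncovered s _ U L col (sym (m+[n∸m]≡n s≤|U|))
  ... | S , |S|≤s , bound = S , |S|≤s ,
    subst₂ (λ a b → s * a ≤ b * length (inColours S L)) split |U|≡s+d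
      (uncovered⇒covered s d _ _
        (subst₂ (λ a b → a * length (outsideColours S L) ≤ d * b) (sym |U|≡s+d) (sym split) bound))
    where
    d = length U ∸ s
    |U|≡s+d : s + d ≡ length U
    |U|≡s+d = m+[n∸m]≡n s≤|U|
    split : length (inColours S L) + length (outsideColours S L) ≡ length L
    split = length-filter-split (λ x → colourOf x ∈? S) L

∸-shift : ∀ m k r → m ∸ r ≤ k + (m ∸ k ∸ r)
∸-shift m k r = m≤n+o⇒m∸n≤o m r (begin
  m ≤⟨ m≤n+m∸n m (k + r) ⟩
  k + r + (m ∸ (k + r)) ≡⟨ cong (_+ (m ∸ (k + r))) (+-comm k r) ⟩
  r + k + (m ∸ (k + r)) ≡⟨ +-assoc r k _ ⟩
  r + (k + (m ∸ (k + r))) ≡⟨ cong (λ x → r + (k + x)) (∸-+-assoc m k r) ⟨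
  r + (k + (m ∸ k ∸ r)) ∎)
  where open ≤-Reasoning

pullback : ∀ {t n m} → Colouring t n → (Fin m → Fin n) → Colouring t m
col (pullback c f) i j = col c (f i) (f j)
symm (pullback c f) i j = symm c (f i) (f j)

pushCopy : ∀ {H t n m} {c : Colouring t n} {f : Fin m → Fin n} → Injective _≡_ _≡_ f →
  MonoCopy H (pullback c f) → MonoCopy H c
colour (pushCopy _ A) = colour A
emb (pushCopy {f = f} _ A) = f ∘ emb A
inj (pushCopy f-inj A) u v eq = inj A u v (f-inj eq)
mono (pushCopy _ A) = mono A

hasMonoCopy-mono : ∀ {t H R m} → HasMonoCopy t H R → R ≤ m → HasMonoCopy t H m
hasMonoCopy-mono has R≤m c =
  pushCopy (FinP.inject≤-injective R≤m R≤m _ _) (has (pullback c (λ i → inject≤ i R≤m)))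

avoidImage : ∀ {m} k (e : Fin k → Fin m) → Injective _≡_ _≡_ e → ∀ d → d + k ≤ m →
  Σ (Fin d → Fin m) λ ρ → Injective _≡_ _≡_ ρ × (∀ i u → ρ i ≢ e u)
avoidImage zero e _ d d+0≤m =
  (λ i → inject≤ i d≤m) , FinP.inject≤-injective d≤m d≤m _ _ , λ _ ()
  where
  d≤m = subst (_≤ _) (+-identityʳ d) d+0≤m
avoidImage {m} (suc k) e e-inj d d+1+k≤m
  with avoidImage k (e ∘ Fin.suc) (FinP.suc-injective ∘ e-inj) (suc d) (subst (_≤ m) (+-suc d k) d+1+k≤m)
... | ρ , ρ-inj , ρ-avoids with FinP.any? (λ j → ρ j FinP.≟ e Fin.zero)
... | yes (j , ρj≡e0) = ρ ∘ punchIn j , FinP.punchIn-injective j _ _ ∘ ρ-inj , avoids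
  where
  avoids : ∀ i u → ρ (punchIn j i) ≢ e u
  avoids i Fin.zero eq = FinP.punchInᵢ≢i j i (ρ-inj (trans eq (sym ρj≡e0)))
  avoids i (Fin.suc u) = ρ-avoids (punchIn j i) u
... | no e0∉ρ = ρ ∘ Fin.suc , FinP.suc-injective ∘ ρ-inj , avoids
  where
  avoids : ∀ i u → ρ (Fin.suc i) ≢ e u
  avoids i Fin.zero eq = e0∉ρ (Fin.suc i , eq)
  avoids i (Fin.suc u) = ρ-avoids (Fin.suc i) u

module GreedyPacking {t n : ℕ} (H : Graph) {R : ℕ} (ramsey : HasMonoCopy t H R)
                     (c : Colouring t n) (k≥1 : 1 ≤ k H) where

  Within : ∀ {m} → (Fin m → Fin n) → MonoCopy H c → Set
  Within ι A = ∀ u → ∃ λ j → emb A u ≡ ι j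

  Packing : (m : ℕ) → (Fin m → Fin n) → Set
  Packing m ι = Σ (List (MonoCopy H c)) λ F →
    AllPairs Disjoint F × All (Within ι) F × m ∸ R ≤ k H * length F

  -- `bound` only bounds the number of rounds (each round removes k H ≥ 1 vertices)
  pack : ∀ bound m → m ≤ bound → (ι : Fin m → Fin n) → Injective _≡_ _≡_ ι → Packing m ι
  pack zero m m≤0 ι _ = [] , [] , [] , ≤-trans (m∸n≤m m R) (≤-trans m≤0 z≤n)
  pack (suc bound) m m≤1+bound ι ι-inj with R ≤? m
  ... | no R≰m = [] , [] , [] , ≤-trans (≤-reflexive (m≤n⇒m∸n≡0 (<⇒≤ (≰⇒> R≰m)))) z≤n
  ... | yes R≤m with hasMonoCopy-mono ramsey R≤m (pullback c ι)
  ... | A′ with avoidImage (k H) (emb A′) (λ {u} {v} → inj A′ u v) (m ∸ k H) (≤-reflexive (m∸n+n≡m k≤m))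
    where
    k≤m : k H ≤ m
    k≤m = FinP.injective⇒≤ (λ {u} {v} → inj A′ u v)
  ... | ρ , ρ-inj , ρ-avoids with pack bound (m ∸ k H) rest≤bound (ι ∘ ρ) (ρ-inj ∘ ι-inj)
    where
    rest≤bound : m ∸ k H ≤ bound
    rest≤bound = ≤-trans (∸-monoʳ-≤ m k≥1) (∸-monoˡ-≤ 1 m≤1+bound)
  ... | F , disjoint , within , covers =
    A ∷ F ,
    All.map (λ {B} → avoidsA {B}) within ∷ disjoint ,
    (λ u → emb A′ u , refl) ∷ All.map (λ {B} → widen {B}) within ,
    covers′
    where
    A : MonoCopy H c
    A = pushCopy ι-inj A′
    avoidsA : {B : MonoCopy H c} → Within (ι ∘ ρ) B → Disjoint A B
    avoidsA B-within u v eq with B-within v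
    ... | j , Bv≡ιρj = ρ-avoids j u (ι-inj (trans (sym Bv≡ιρj) (sym eq)))
    widen : {B : MonoCopy H c} → Within (ι ∘ ρ) B → Within ι B
    widen B-within v with B-within v
    ... | j , Bv≡ιρj = ρ j , Bv≡ιρj
    covers′ : m ∸ R ≤ k H * length (A ∷ F)
    covers′ = begin
      m ∸ R ≤⟨ ∸-shift m (k H) R ⟩
      k H + (m ∸ k H ∸ R) ≤⟨ +-monoʳ-≤ (k H) covers ⟩
      k H + k H * length F ≡⟨ *-suc (k H) (length F) ⟨
      k H * length (A ∷ F) ∎
      where open ≤-Reasoning

nonBipartite⇒nonEmpty : (H : Graph) → ¬ Bipartite H → 1 ≤ k H
nonBipartite⇒nonEmpty H nonBipartite = n≢0⇒n>0 λ k≡0 →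
  let noVertex = λ (u : Fin (k H)) → FinP.¬Fin0 (subst Fin k≡0 u)
  in nonBipartite ((λ u → ⊥-elim (noVertex u)) , λ u _ _ → ⊥-elim (noVertex u))

length-allFin : ∀ t → length (allFin t) ≡ t
length-allFin t = length-tabulate id

largeGoodFamily : ∀ {t} s → s ≤ t → (H : Graph) → ¬ Bipartite H → ∀ {R} → HasMonoCopy t H R →
  ∀ n (c : Colouring t n) →
  Σ (List (MonoCopy H c)) λ F → GoodFamily H c s F × s * (n ∸ R) ≤ t * covered F
largeGoodFamily {t} s s≤t H nonBipartite {R} ramsey n c
  with GreedyPacking.pack H ramsey c (nonBipartite⇒nonEmpty H nonBipartite) n n ≤-refl id id
... | F , disjoint , _ , covers
  with ColourSelection.selectColours FinP._≟_ colour s (allFin t) F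
         (All.universal (∈-allFin ∘ colour) F) (subst (s ≤_) (sym (length-allFin t)) s≤t)
... | S , |S|≤s , share =
  inColours S F , (AllPairs.filter⁺ _ disjoint , S , |S|≤s , all-filter _ F) , (begin
    s * (n ∸ R) ≤⟨ *-monoʳ-≤ s covers ⟩
    s * (k H * length F) ≡⟨ *-left-comm s (k H) _ ⟩
    k H * (s * length F)
      ≤⟨ *-monoʳ-≤ (k H) (subst (λ u → s * length F ≤ u * length (inColours S F)) (length-allFin t) share) ⟩
    k H * (t * length (inColours S F)) ≡⟨ *-left-comm (k H) t _ ⟩
    t * (k H * length (inColours S F)) ∎)
  where
  open ≤-Reasoning
  open ColourSelection FinP._≟_ (colour {H} {t} {n} {c}) using (inColours)

-- The colour of an edge between parts lo < hi: lo − 1 if lo ≥ 1, hi − 1 if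
-- lo = 0 < 1 < hi, and 2 for the parts 0 and 1. It is a colour (when t ≥ 3)
-- different from lo and from hi.
bridge : ℕ → ℕ → ℕ
bridge (suc lo) _ = lo
bridge zero (suc (suc hi)) = suc hi
bridge zero _ = 2

bridge<t : ∀ {t} lo hi → lo < hi → hi < t → 2 < t → bridge lo hi < t
bridge<t (suc lo) hi lo<hi hi<t _ = <-trans (<-trans (n<1+n lo) lo<hi) hi<t
bridge<t zero (suc zero) _ _ 2<t = 2<t
bridge<t zero (suc (suc hi)) _ hi<t _ = <-trans (n<1+n (suc hi)) hi<t

bridge≢lo : ∀ lo hi → lo < hi → bridge lo hi ≢ lo
bridge≢lo (suc lo) _ _ eq = 1+n≢n (sym eq)
bridge≢lo zero (suc zero) _ ()
bridge≢lo zero (suc (suc hi)) _ ()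

bridge≢hi : ∀ lo hi → lo < hi → bridge lo hi ≢ hi
bridge≢hi (suc lo) hi lo<hi refl = <-irrefl refl (<-trans (n<1+n lo) lo<hi)
bridge≢hi zero (suc zero) _ ()
bridge≢hi zero (suc (suc hi)) _ eq = 1+n≢n (sym eq)

-- The edges of colour i between distinct parts form a bipartite graph on
-- the parts: each joins a marked part (part i + 1, and part 1 for i = 2)
-- to an unmarked one.
marked : ℕ → ℕ → Bool
marked i a = (a ≡ᵇ suc i) ∨ ((i ≡ᵇ 2) ∧ (a ≡ᵇ 1))

≡ᵇ-refl : ∀ n → (n ≡ᵇ n) ≡ true
≡ᵇ-refl zero = refl
≡ᵇ-refl (suc n) = ≡ᵇ-refl n

≢⇒≡ᵇ-false : ∀ m n → m ≢ n → (m ≡ᵇ n) ≡ false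
≢⇒≡ᵇ-false zero zero m≢n = contradiction refl m≢n
≢⇒≡ᵇ-false zero (suc _) _ = refl
≢⇒≡ᵇ-false (suc _) zero _ = refl
≢⇒≡ᵇ-false (suc m) (suc n) m≢n = ≢⇒≡ᵇ-false m n (m≢n ∘ cong suc)

differ : ∀ {x y : Bool} → x ≡ true → y ≡ false → x ≢ y
differ refl refl ()

bridge-separates : ∀ lo hi → lo < hi → marked (bridge lo hi) lo ≢ marked (bridge lo hi) hi
bridge-separates (suc lo) hi lo<hi = differ lo-marked hi-unmarked
  where
  lo-marked : marked lo (suc lo) ≡ true
  lo-marked rewrite ≡ᵇ-refl lo = refl
  hi-unmarked : marked lo hi ≡ false
  hi-unmarked rewrite ≢⇒≡ᵇ-false hi (suc lo) (λ { refl → <-irrefl refl lo<hi })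
                    | ≢⇒≡ᵇ-false hi 1 (λ { refl → <⇒≱ lo<hi (s≤s z≤n) })
                    | ∧-zeroʳ (lo ≡ᵇ 2) = refl
bridge-separates zero (suc zero) _ ()
bridge-separates zero (suc (suc hi)) _ = differ hi-marked lo-unmarked ∘ sym
  where
  lo-unmarked : marked (suc hi) 0 ≡ false
  lo-unmarked rewrite ∧-zeroʳ (suc hi ≡ᵇ 2) = refl
  hi-marked : marked (suc hi) (suc (suc hi)) ≡ true
  hi-marked rewrite ≡ᵇ-refl hi = refl

partColour : ℕ → ℕ → ℕ
partColour a b with <-cmp a b
... | tri< _ _ _ = bridge a b
... | tri≈ _ _ _ = a
... | tri> _ _ _ = bridge b a

partColour-sym : ∀ a b → partColour a b ≡ partColour b a
partColour-sym a b with <-cmp a b | <-cmp b a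
... | tri< a<b _ _ | tri< b<a _ _ = contradiction b<a (<-asym a<b)
... | tri< _ a≢b _ | tri≈ _ b≡a _ = contradiction (sym b≡a) a≢b
... | tri< _ _ _ | tri> _ _ _ = refl
... | tri≈ _ a≡b _ | tri< _ b≢a _ = contradiction (sym a≡b) b≢a
... | tri≈ _ a≡b _ | tri≈ _ _ _ = a≡b
... | tri≈ _ a≡b _ | tri> _ b≢a _ = contradiction (sym a≡b) b≢a
... | tri> _ _ _ | tri< _ _ _ = refl
... | tri> _ a≢b _ | tri≈ _ b≡a _ = contradiction (sym b≡a) a≢b
... | tri> _ _ b<a | tri> _ _ a<b = contradiction b<a (<-asym a<b)

partColour<t : ∀ {t} a b → a < t → b < t → 2 < t → partColour a b < t
partColour<t a b a<t b<t 2<t with <-cmp a b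
... | tri< a<b _ _ = bridge<t a b a<b b<t 2<t
... | tri≈ _ _ _ = a<t
... | tri> _ _ b<a = bridge<t b a b<a a<t 2<t

partColour-stays : ∀ a b i → partColour a b ≡ i → b ≡ i → a ≡ i
partColour-stays a b i col≡i b≡i with <-cmp a b
... | tri< a<b _ _ = contradiction (trans col≡i (sym b≡i)) (bridge≢hi a b a<b)
... | tri≈ _ a≡b _ = trans a≡b b≡i
... | tri> _ _ b<a = contradiction (trans col≡i (sym b≡i)) (bridge≢lo b a b<a)

partColour-separates : ∀ a b i → partColour a b ≡ i → a ≢ i → marked i a ≢ marked i b
partColour-separates a b i col≡i a≢i with <-cmp a b
... | tri< a<b _ _ = subst (λ j → marked j a ≢ marked j b) col≡i (bridge-separates a b a<b)
... | tri≈ _ _ _ = contradiction col≡i a≢i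
... | tri> _ _ b<a = subst (λ j → marked j a ≢ marked j b) col≡i (bridge-separates b a b<a ∘ sym)

disjoint-index : ∀ {H t n} {c : Colouring t n} {F : List (MonoCopy H c)} → AllPairs Disjoint F →
  ∀ j j′ u u′ → emb (lookup F j) u ≡ emb (lookup F j′) u′ → j ≡ j′
disjoint-index (_ ∷ _) Fin.zero Fin.zero _ _ _ = refl
disjoint-index (A-disj ∷ _) Fin.zero (Fin.suc j′) u u′ eq =
  contradiction eq (All.lookup A-disj (∈-lookup j′) u u′)
disjoint-index (A-disj ∷ _) (Fin.suc j) Fin.zero u u′ eq =
  contradiction (sym eq) (All.lookup A-disj (∈-lookup j) u′ u)
disjoint-index (_ ∷ disj) (Fin.suc j) (Fin.suc j′) u u′ eq =
  cong Fin.suc (disjoint-index disj j j′ u u′ eq)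

remQuot-injective : ∀ {m} n {x y : Fin (m * n)} → remQuot {m} n x ≡ remQuot n y → x ≡ y
remQuot-injective {m} n {x} {y} eq = begin
  x ≡⟨ FinP.combine-remQuot {m} n x ⟨
  uncurry combine (remQuot {m} n x) ≡⟨ cong (uncurry combine) eq ⟩
  uncurry combine (remQuot {m} n y) ≡⟨ FinP.combine-remQuot {m} n y ⟩
  y ∎
  where open ≡-Reasoning

module Parts {t q : ℕ} where
  offset : Fin (q * t) → Fin q
  offset v = proj₁ (remQuot {q} t v)

  part : Fin (q * t) → Fin t
  part v = proj₂ (remQuot {q} t v)

  offset-part-injective : ∀ {v w} → offset v ≡ offset w → part v ≡ part w → v ≡ w
  offset-part-injective same-offset same-part = remQuot-injective t (cong₂ _,_ same-offset same-part)

  inParts-bound : ∀ {H} {c : Colouring t (q * t)} (F : List (MonoCopy H c)) (S : List (Fin t))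
    (label : MonoCopy H c → Fin t) → AllPairs Disjoint F → All (λ A → label A ∈ S) F →
    (∀ A u → part (emb A u) ≡ label A) → length F * k H ≤ length S * q
  inParts-bound {H} F S label disj labelled inPart =
    FinP.injective⇒≤ {f = encode ∘ remQuot (k H)} (remQuot-injective (k H) ∘ encode-injective)
    where
    slot : Fin (length F) → Fin (length S)
    slot j = Any.index (All.lookup labelled (∈-lookup j))
    slot-label : ∀ j → label (lookup F j) ≡ lookup S (slot j)
    slot-label j = lookup-index (All.lookup labelled (∈-lookup j))
    encode : Fin (length F) × Fin (k H) → Fin (length S * q)
    encode (j , u) = combine (slot j) (offset (emb (lookup F j) u))
    same-vertex : ∀ j j′ u u′ → slot j ≡ slot j′ →
      offset (emb (lookup F j) u) ≡ offset (emb (lookup F j′) u′) → emb (lookup F j) u ≡ emb (lookup F j′) u′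
    same-vertex j j′ u u′ same-slot same-offset = offset-part-injective same-offset (begin
      part (emb (lookup F j) u) ≡⟨ inPart _ u ⟩
      label (lookup F j) ≡⟨ slot-label j ⟩
      lookup S (slot j) ≡⟨ cong (lookup S) same-slot ⟩
      lookup S (slot j′) ≡⟨ slot-label j′ ⟨
      label (lookup F j′) ≡⟨ inPart _ u′ ⟨
      part (emb (lookup F j′) u′) ∎)
      where open ≡-Reasoning
    encode-injective : ∀ {x y} → encode x ≡ encode y → x ≡ y
    encode-injective {j , u} {j′ , u′} eq with FinP.combine-injective _ _ _ _ eq
    ... | same-slot , same-offset
      with disjoint-index disj j j′ u u′ (same-vertex j j′ u u′ same-slot same-offset)
    ... | refl = cong (j ,_) (inj (lookup F j) u u′ (same-vertex j j u u′ same-slot same-offset))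

module PartColouring {t q : ℕ} (2<t : 2 < t) where
  open Parts {t} {q}

  partIndex : Fin (q * t) → ℕ
  partIndex v = toℕ (part v)

  colouring : Colouring t (q * t)
  col colouring u v =
    fromℕ< (partColour<t (partIndex u) (partIndex v) (FinP.toℕ<n _) (FinP.toℕ<n _) 2<t)
  symm colouring u v = FinP.fromℕ<-cong _ _ (partColour-sym (partIndex u) (partIndex v)) _ _

  edge-colour : ∀ {H} (A : MonoCopy H colouring) {v w} → Adj H v w →
    partColour (partIndex (emb A v)) (partIndex (emb A w)) ≡ toℕ (colour A)
  edge-colour A {v} {w} adj = trans (sym (FinP.toℕ-fromℕ< _)) (cong toℕ (mono A v w adj))

  stays-outside : ∀ {H} (A : MonoCopy H colouring) {v w} → Reach H v w →
    partIndex (emb A v) ≢ toℕ (colour A) → partIndex (emb A w) ≢ toℕ (colour A)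
  stays-outside A here outside = outside
  stays-outside A (step adj walk) outside =
    stays-outside A walk (outside ∘ partColour-stays _ _ _ (edge-colour A adj))

  -- A monochromatic copy of a connected non-bipartite graph lies inside
  -- the part of its colour: otherwise, by connectivity, it avoids that
  -- part entirely, and `marked` would be a proper 2-colouring of H.
  inOwnPart : ∀ {H} → Connected H → ¬ Bipartite H →
    (A : MonoCopy H colouring) → ∀ u → part (emb A u) ≡ colour A
  inOwnPart {H} connected nonBipartite A u with partIndex (emb A u) ℕ.≟ toℕ (colour A)
  ... | yes inside = FinP.toℕ-injective inside
  ... | no outside = contradiction bipartition nonBipartite
    where
    bipartition : Bipartite H
    bipartition = (λ v → marked (toℕ (colour A)) (partIndex (emb A v))) , λ v w adj →
      partColour-separates _ _ _ (edge-colour A adj) (stays-outside A (connected u v) outside)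

noLargeGoodFamily : ∀ {t} s → 3 ≤ t → (H : Graph) → Connected H → ¬ Bipartite H →
  ∀ n → t ∣ n → Σ (Colouring t n) λ c →
    (F : List (MonoCopy H c)) → GoodFamily H c s F → t * covered F ≤ s * n
noLargeGoodFamily {t} s 3≤t H connected nonBipartite _ (divides q refl) =
  colouring , λ F (disjoint , S , |S|≤s , coloured) → begin
    t * (k H * length F) ≡⟨ cong (t *_) (*-comm (k H) (length F)) ⟩
    t * (length F * k H)
      ≤⟨ *-monoʳ-≤ t (inParts-bound F S colour disjoint coloured (inOwnPart connected nonBipartite)) ⟩
    t * (length S * q) ≤⟨ *-monoʳ-≤ t (*-monoˡ-≤ q |S|≤s) ⟩
    t * (s * q) ≡⟨ *-left-comm t s q ⟩
    s * (t * q) ≡⟨ cong (s *_) (*-comm t q) ⟩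
    s * (q * t) ∎
  where
  open ≤-Reasoning
  open Parts {t} {q}
  open PartColouring {t} {q} 3≤t

theorem11 : (t s : ℕ) → 3 ≤ t → 1 ≤ s → s ≤ t →
    (H : Graph) → Connected H → ¬ Bipartite H →
    (R : ℕ) → IsRamseyNumber t H R →
    ((n : ℕ) → (c : Colouring t n) →
      Σ (List (MonoCopy H c)) λ F → GoodFamily H c s F × s * (n ∸ R) ≤ t * covered F)
    ×
    ((n : ℕ) → t ∣ n → Σ (Colouring t n) λ c →
      (F : List (MonoCopy H c)) → GoodFamily H c s F → t * covered F ≤ s * n)
theorem11 t s 3≤t _ s≤t H connected nonBipartite R (ramsey , _) =
  largeGoodFamily s s≤t H nonBipartite ramsey ,
  noLargeGoodFamily s 3≤t H connected nonBipartite
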